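{- Let $q$ be a prime power, $n,k$ positive integers, and $U$ a $k$-dimensional $\mathbb{F}_q$-subspace of $\mathbb{F}_{q^n}$. Then $U$ is a Sidon space if and only if the only points of $L_{U\times U}\subseteq\mathrm{PG}(1,q^n)=\mathrm{PG}(\mathbb{F}_{q^n}\times\mathbb{F}_{q^n},\mathbb{F}_{q^n})$ of weight greater than one are those in $L_{U\times U}\cap\mathrm{PG}(\mathbb{F}_q\times\mathbb{F}_q,\mathbb{F}_q)$, i.e. points $\langle(a,b)\rangle_{\mathbb{F}_{q^n}}$ with $(a,b)\in\mathbb{F}_q^2\setminus\{(0,0)\}$. Furthermore, the weight of such points is $k$. In particular, if $U$ is a Sidon space then $|L_{U\times U}|=\frac{q^k-1}{q-1}(q^k-q)+q+1$.
   Context: An $\mathbb{F}_q$-subspace $U$ of $\mathbb{F}_{q^n}$ is a Sidon space if for all nonzero $a,b,c,d\in U$, $ab=cd$ implies $\{a\mathbb{F}_q,b\mathbb{F}_q\}=\{c\mathbb{F}_q,d\mathbb{F}_q\}$, where $e\mathbb{F}_q=\{e\lambda:\lambda\in\mathbb{F}_q\}$. For an $\mathbb{F}_q$-subspace $W$ of $\mathbb{F}_{q^n}^2$, $L_W=\{\langle\mathbf{w}\rangle_{\mathbb{F}_{q^n}}:\mathbf{w}\in W\setminus\{\mathbf{0}\}\}\subseteq\mathrm{PG}(1,q^n)$, and the weight of a point $P=\langle\mathbf{v}\rangle_{\mathbb{F}_{q^n}}$ is $w_{L_W}(P)=\dim_{\mathbb{F}_q}(W\cap\langle\mathbf{v}\rangle_{\mathbb{F}_{q^n}})$.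 $U\times U=\{(a,b):a,b\in U\}$. -}

module Defs where

open import Level using (0ℓ)
open import Data.Nat using (ℕ; zero; suc; _^_; _≤_; _<_)
open import Data.Nat.Primality using (Prime)
open import Data.Product using (Σ; ∃; _×_; _,_)
open import Data.Sum using (_⊎_)
open import Data.List using (List; length)
open import Data.List.Membership.Propositional using (_∈_)
open import Data.List.Relation.Unary.All as LAll using ()
open import Data.List.Relation.Unary.Unique.Propositional using (Unique)
open import Data.Vec using (Vec; []; _∷_)
open import Data.Vec.Relation.Unary.All using (All)
open import Relation.Binary.PropositionalEquality using (_≡_; _≢_)
open import Relation.Nullary using (¬_)
open import Function.Bundles using (_⇔_)
open import Algebra.Structures using (IsCommutativeRing)

IsPrimePower : ℕ → Set
IsPrimePower q = Σ ℕ λ p → Σ ℕ λ e → Prime p × 1 ≤ e × q ≡ p ^ e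

record FiniteField : Set₁ where
  infixl 7 _*_
  infixl 6 _+_
  field
    Carrier : Set
    _+_ _*_ : Carrier → Carrier → Carrier
    -_      : Carrier → Carrier
    0# 1#   : Carrier
    isCommutativeRing : IsCommutativeRing _≡_ _+_ _*_ -_ 0# 1#
    0≢1     : 0# ≢ 1#
    inverse : ∀ x → x ≢ 0# → Σ Carrier λ y → x * y ≡ 1#
    elements : List Carrier
    elements-unique   : Unique elements
    elements-complete : ∀ x → x ∈ elements

FieldCard : FiniteField → ℕ → Set
FieldCard K m = length (FiniteField.elements K) ≡ m

module _ (K : FiniteField) where
  open FiniteField K

  record Subfield : Set₁ where
    field
      mem     : Carrier → Set
      0∈      : mem 0#
      1∈      : mem 1#
      +-closed : ∀ {x y} → mem x → mem y → mem (x + y)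
      *-closed : ∀ {x y} → mem x → mem y → mem (x * y)
      neg-closed : ∀ {x} → mem x → mem (- x)
      inv-closed : ∀ {x y} → mem x → x * y ≡ 1# → mem y

  SetCard : {A : Set} → (A → Set) → ℕ → Set
  SetCard {A} S m = Σ (List A) λ xs →
    Unique xs × LAll.All S xs × (∀ a → S a → a ∈ xs) × length xs ≡ m

  record KSpace : Set₁ where
    field
      V   : Set
      _⊕_ : V → V → V
      𝟘   : V
      _•_ : Carrier → V → V

  KasSpace : KSpace
  KasSpace = record { V = Carrier ; _⊕_ = _+_ ; 𝟘 = 0# ; _•_ = _*_ }

  K²Space : KSpace
  K²Space = record
    { V   = Carrier × Carrier
    ; _⊕_ = λ { (a , b) (c , d) → (a + c , b + d) }
    ; 𝟘   = (0# , 0#)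
    ; _•_ = λ { λ' (a , b) → (λ' * a , λ' * b) }
    }

  module _ (M : KSpace) (F : Subfield) where
    open KSpace M
    open Subfield F renaming (mem to inF)

    combo : ∀ {d} → Vec Carrier d → Vec V d → V
    combo [] [] = 𝟘
    combo (c ∷ cs) (v ∷ vs) = (c • v) ⊕ combo cs vs

    HasDim : (V → Set) → ℕ → Set
    HasDim S d = Σ (Vec V d) λ bs →
        All S bs
      × (∀ v → S v → Σ (Vec Carrier d) λ cs → All inF cs × v ≡ combo cs bs)
      × (∀ cs → All inF cs → combo cs bs ≡ 𝟘 → All (_≡ 0#) cs)

  module _ (F : Subfield) where
    open Subfield F renaming (mem to inF)

    record IsFSubspace (U : Carrier → Set) : Set where
      field
        0∈U : U 0#
        +-closed : ∀ {x y} → U x → U y → U (x + y)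
        scale-closed : ∀ {λ' x} → inF λ' → U x → U (λ' * x)

    _𝔽 : Carrier → Carrier → Set
    (e 𝔽) z = Σ Carrier λ λ' → inF λ' × z ≡ e * λ'

    _≐_ : (Carrier → Set) → (Carrier → Set) → Set
    A ≐ B = ∀ z → A z ⇔ B z

    IsSidon : (Carrier → Set) → Set
    IsSidon U = ∀ a b c d → U a → U b → U c → U d →
      a ≢ 0# → b ≢ 0# → c ≢ 0# → d ≢ 0# →
      a * b ≡ c * d →
      ((a 𝔽) ≐ (c 𝔽) × (b 𝔽) ≐ (d 𝔽)) ⊎ ((a 𝔽) ≐ (d 𝔽) × (b 𝔽) ≐ (c 𝔽))

    _×ˢ_ : (Carrier → Set) → (Carrier → Set) → Carrier × Carrier → Set
    (U ×ˢ U') (a , b) = U a × U' b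

    NonZero² : Carrier × Carrier → Set
    NonZero² v = v ≢ (0# , 0#)

    -- the K-span ⟨ v ⟩_K ⊆ K²  (the projective point determined by v)
    ⟨_⟩ : Carrier × Carrier → Carrier × Carrier → Set
    ⟨ (a , b) ⟩ z = Σ Carrier λ μ → z ≡ (μ * a , μ * b)

    _≐²_ : (Carrier × Carrier → Set) → (Carrier × Carrier → Set) → Set
    A ≐² B = ∀ z → A z ⇔ B z

    InL : (Carrier × Carrier → Set) → Carrier × Carrier → Set
    InL W v = Σ (Carrier × Carrier) λ w → W w × NonZero² w × (⟨ w ⟩ ≐² ⟨ v ⟩)

    InPGFq : Carrier × Carrier → Set
    InPGFq v = Σ (Carrier × Carrier) λ { (a , b) →
      inF a × inF b × NonZero² (a , b) × (⟨ (a , b) ⟩ ≐² ⟨ v ⟩) }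

    _∩⟨_⟩ : (Carrier × Carrier → Set) → Carrier × Carrier → Carrier × Carrier → Set
    (W ∩⟨ v ⟩) z = W z × ⟨ v ⟩ z

    Weight : (Carrier × Carrier → Set) → Carrier × Carrier → ℕ → Set
    Weight W v w = HasDim K²Space F (W ∩⟨ v ⟩) w

    PointCard : (Carrier × Carrier → Set) → ℕ → Set
    PointCard W m = Σ (List (Carrier × Carrier)) λ ps →
        LAll.All (λ p → W p × NonZero² p) ps
      × AllPairs (λ p p' → ¬ (⟨ p ⟩ ≐² ⟨ p' ⟩)) ps
      × (∀ v → NonZero² v → InL W v →
           Σ (Carrier × Carrier) λ p → p ∈ ps × (⟨ p ⟩ ≐² ⟨ v ⟩))
      × length ps ≡ m
      where open import Data.List.Relation.Unary.AllPairs using (AllPairs)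

module Submission where

-- Write W = U × U. If x = (x₁, x₂) and λx both lie in W, then x₁ · λx₂ = λx₁ · x₂, and the
-- Sidon property leaves two options: λ ∈ F_q, or x₁F_q = x₂F_q, so that ⟨x⟩ is F_q-rational (as
-- it is anyway when a coordinate of x vanishes). So a point of weight at least 2, which carries
-- two F_q-independent vectors x and λx, is rational. Conversely, if ab = cd with ρ = a/d ∉ F_q,
-- then (d, b) and (a, c) = ρ(d, b) are F_q-independent vectors of W on one point; if that point
-- is rational then b/d = c/a ∈ F_q. A rational point ⟨(e, f)⟩ meets W in U·(e, f), of dimension
-- k. Finally, sorting the q^{2k} − 1 nonzero vectors of W by the point they span, the q + 1
-- rational points carry q^k − 1 each and every other point carries q − 1 (its vectors are the
-- F_q-multiples of one of them), which gives the number of points.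

open import Defs
open import Data.Nat using (ℕ; suc)

module ListCounting where

  open import Data.Nat using (ℕ; suc; _+_; _*_)
  open import Data.Nat.ListAction using (sum)
  open import Data.Nat.Properties using (+-assoc; +-commutativeSemigroup)
  open import Algebra.Properties.CommutativeSemigroup +-commutativeSemigroup using (interchange)
  open import Data.Product using (_×_; _,_; proj₁; proj₂)
  open import Data.List using (List; []; _∷_; length; map; filter; concat; cartesianProductWith)
  open import Data.List.Properties using (length-++; length-map; map-∘)
  open import Data.List.Membership.Propositional using (_∈_)
  open import Data.List.Membership.Propositional.Properties
    using (∈-filter⁺; ∈-filter⁻; ∈-map⁺; ∈-map⁻; ∈-concat⁺′; ∈-concat⁻′)
  open import Data.List.Membership.Propositional.Properties.WithK using (unique∧set⇒bag)
  open import Data.List.Relation.Binary.BagAndSetEquality using (∼bag⇒↭)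
  open import Data.List.Relation.Binary.Permutation.Propositional.Properties using (↭-length)
  open import Data.List.Relation.Unary.Any using (here; there)
  open import Data.List.Relation.Unary.All as All using (All)
  import Data.List.Relation.Unary.All.Properties as All
  open import Data.List.Relation.Unary.AllPairs as AllPairs using (AllPairs; []; _∷_)
  import Data.List.Relation.Unary.AllPairs.Properties as AllPairs
  open import Data.List.Relation.Unary.Unique.Propositional using (Unique)
  import Data.List.Relation.Unary.Unique.Propositional.Properties as Unique
  open import Function.Bundles using (_⇔_; mk⇔; Equivalence)
  open import Function.Base using (_∘_)
  open import Data.Empty using (⊥-elim)
  open import Relation.Binary using (DecidableEquality)
  open import Relation.Binary.PropositionalEquality
  open import Relation.Nullary using (¬_; Dec; yes; no; ¬?)
  open import Relation.Unary using (Decidable)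

  length-unique-≡ : {A : Set} {xs ys : List A} → Unique xs → Unique ys →
    (∀ {z} → z ∈ xs ⇔ z ∈ ys) → length xs ≡ length ys
  length-unique-≡ ux uy xs⇔ys = ↭-length (∼bag⇒↭ (unique∧set⇒bag ux uy xs⇔ys))

  unique⇒allPairs : {A : Set} {Q : A → A → Set} {xs : List A} → Unique xs →
    (∀ {x y} → x ∈ xs → y ∈ xs → Q x y → x ≡ y) → AllPairs (λ x y → ¬ Q x y) xs
  unique⇒allPairs [] _ = []
  unique⇒allPairs (x∉xs ∷ u) Q⇒≡ =
    All.tabulate (λ y∈ Qxy → All.lookup x∉xs y∈ (Q⇒≡ (here refl) (there y∈) Qxy))
      ∷ unique⇒allPairs u (λ x∈ y∈ → Q⇒≡ (there x∈) (there y∈))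

  map⁺-∈ : {A B : Set} (f : A → B) {xs : List A} → Unique xs →
    (∀ {x y} → x ∈ xs → y ∈ xs → f x ≡ f y → x ≡ y) → Unique (map f xs)
  map⁺-∈ f u inj = AllPairs.map⁺ (unique⇒allPairs u inj)

  module WithDecidableEquality {A : Set} (_≟_ : DecidableEquality A) where

    _without_ : List A → A → List A
    xs without z = filter (λ y → ¬? (y ≟ z)) xs

    ∈-without⁻ : ∀ {xs z y} → y ∈ xs without z → y ∈ xs × y ≢ z
    ∈-without⁻ {xs} {z} = ∈-filter⁻ (λ y → ¬? (y ≟ z)) {xs = xs}

    ∈-without⁺ : ∀ {xs z y} → y ∈ xs → y ≢ z → y ∈ xs without z
    ∈-without⁺ {z = z} = ∈-filter⁺ (λ y → ¬? (y ≟ z))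

    without-unique : ∀ {xs} z → Unique xs → Unique (xs without z)
    without-unique z = Unique.filter⁺ (λ y → ¬? (y ≟ z))

    length-without : ∀ {xs z} → Unique xs → z ∈ xs → suc (length (xs without z)) ≡ length xs
    length-without {xs} {z} u z∈xs = length-unique-≡ (z∉ ∷ without-unique z u) u (mk⇔ to from)
      where
      z∉ : All (z ≢_) (xs without z)
      z∉ = All.tabulate (λ y∈ z≡y → proj₂ (∈-without⁻ {xs} y∈) (sym z≡y))
      to : ∀ {y} → y ∈ z ∷ xs without z → y ∈ xs
      to (here refl) = z∈xs
      to (there y∈) = proj₁ (∈-without⁻ {xs} y∈)
      from : ∀ {y} → y ∈ xs → y ∈ z ∷ xs without z
      from {y} y∈ with y ≟ z
      ... | yes refl = here refl
      ... | no y≢z = there (∈-without⁺ y∈ y≢z)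

  length-cartesianProductWith : {A B C : Set} (f : A → B → C) (xs : List A) (ys : List B) →
    length (cartesianProductWith f xs ys) ≡ length xs * length ys
  length-cartesianProductWith f [] ys = refl
  length-cartesianProductWith f (x ∷ xs) ys =
    trans (length-++ (map (f x) ys)) (cong₂ _+_ (length-map (f x) ys) (length-cartesianProductWith f xs ys))

  length-concat : {A : Set} (xss : List (List A)) → length (concat xss) ≡ sum (map length xss)
  length-concat [] = refl
  length-concat (xs ∷ xss) = trans (length-++ xs) (cong (length xs +_) (length-concat xss))

  sum-map-split : {B : Set} {P : B → Set} (P? : Decidable P) (f : B → ℕ) (a b : ℕ) (xs : List B) →
    (∀ {x} → x ∈ xs → (P x → f x ≡ a + b) × (¬ P x → f x ≡ a)) →
    sum (map f xs) ≡ length xs * a + length (filter P? xs) * b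
  sum-map-split P? f a b [] _ = refl
  sum-map-split P? f a b (x ∷ xs) fx with P? x | sum-map-split P? f a b xs (λ x∈ → fx (there x∈))
  ... | yes Px | ih = trans (cong₂ _+_ (proj₁ (fx (here refl)) Px) ih) (interchange a b _ _)
  ... | no ¬Px | ih = trans (cong₂ _+_ (proj₂ (fx (here refl)) ¬Px) ih) (sym (+-assoc a _ _))

  module EquivalenceClasses
    {A : Set} (_≟_ : DecidableEquality A)
    (_∼_ : A → A → Set) (_∼?_ : ∀ x y → Dec (x ∼ y))
    (Z : List A) (Z-unique : Unique Z)
    (∼-refl : ∀ x → x ∼ x)
    (∼-trans : ∀ {x y z} → x ∼ y → y ∼ z → x ∼ z)
    (∼-sym : ∀ {x y} → y ∈ Z → x ∼ y → y ∼ x)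
    where

    private
      firstEquiv : List A → A → A
      firstEquiv [] x = x
      firstEquiv (z ∷ zs) x with z ∼? x
      ... | yes _ = z
      ... | no _ = firstEquiv zs x

      firstEquiv-spec : ∀ zs {x} → x ∈ zs → firstEquiv zs x ∈ zs × firstEquiv zs x ∼ x
      firstEquiv-spec (z ∷ zs) {x} x∈ with z ∼? x | x∈
      ... | yes z∼x | _ = here refl , z∼x
      ... | no z≁x | here refl = ⊥-elim (z≁x (∼-refl z))
      ... | no _ | there x∈zs = let e∈ , e∼x = firstEquiv-spec zs x∈zs in there e∈ , e∼x

      firstEquiv-cong : ∀ zs {x y} → x ∈ zs → (∀ z → z ∼ x ⇔ z ∼ y) → firstEquiv zs x ≡ firstEquiv zs y
      firstEquiv-cong (z ∷ zs) {x} {y} x∈ ∼x⇔∼y with z ∼? x | z ∼? y | x∈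
      ... | yes _ | yes _ | _ = refl
      ... | yes z∼x | no z≁y | _ = ⊥-elim (z≁y (Equivalence.to (∼x⇔∼y z) z∼x))
      ... | no z≁x | yes z∼y | _ = ⊥-elim (z≁x (Equivalence.from (∼x⇔∼y z) z∼y))
      ... | no z≁x | no _ | here refl = ⊥-elim (z≁x (∼-refl z))
      ... | no _ | no _ | there x∈zs = firstEquiv-cong zs x∈zs ∼x⇔∼y

    rep : A → A
    rep = firstEquiv Z

    rep-∈ : ∀ {x} → x ∈ Z → rep x ∈ Z
    rep-∈ x∈ = proj₁ (firstEquiv-spec Z x∈)

    rep-∼ : ∀ {x} → x ∈ Z → rep x ∼ x
    rep-∼ x∈ = proj₂ (firstEquiv-spec Z x∈)

    rep-cong : ∀ {x y} → x ∈ Z → y ∈ Z → x ∼ y → rep x ≡ rep y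
    rep-cong x∈ y∈ x∼y = firstEquiv-cong Z x∈ λ z →
      mk⇔ (λ z∼x → ∼-trans z∼x x∼y) (λ z∼y → ∼-trans z∼y (∼-sym y∈ x∼y))

    reps : List A
    reps = filter (λ x → rep x ≟ x) Z

    reps-unique : Unique reps
    reps-unique = Unique.filter⁺ (λ x → rep x ≟ x) Z-unique

    ∈-reps⁻ : ∀ {r} → r ∈ reps → r ∈ Z × rep r ≡ r
    ∈-reps⁻ = ∈-filter⁻ (λ x → rep x ≟ x) {xs = Z}

    rep-∈-reps : ∀ {x} → x ∈ Z → rep x ∈ reps
    rep-∈-reps x∈ = ∈-filter⁺ (λ x → rep x ≟ x) (rep-∈ x∈) (rep-cong (rep-∈ x∈) x∈ (rep-∼ x∈))

    reps-injective : ∀ {r r'} → r ∈ reps → r' ∈ reps → r ∼ r' → r ≡ r'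
    reps-injective r∈ r'∈ r∼r' =
      trans (sym (proj₂ (∈-reps⁻ r∈)))
        (trans (rep-cong (proj₁ (∈-reps⁻ r∈)) (proj₁ (∈-reps⁻ r'∈)) r∼r') (proj₂ (∈-reps⁻ r'∈)))

    class : A → List A
    class r = filter (λ x → rep x ≟ r) Z

    class-unique : ∀ r → Unique (class r)
    class-unique r = Unique.filter⁺ (λ x → rep x ≟ r) Z-unique

    ∈-class⇔ : ∀ {r x} → r ∈ reps → x ∈ class r ⇔ (x ∈ Z × r ∼ x)
    ∈-class⇔ {r} {x} r∈ = mk⇔ to from
      where
      to : x ∈ class r → x ∈ Z × r ∼ x
      to x∈ with ∈-filter⁻ (λ x → rep x ≟ r) x∈
      ... | x∈Z , refl = x∈Z , rep-∼ x∈Z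
      from : x ∈ Z × r ∼ x → x ∈ class r
      from (x∈Z , r∼x) = ∈-filter⁺ (λ x → rep x ≟ r) x∈Z
        (trans (rep-cong x∈Z (proj₁ (∈-reps⁻ r∈)) (∼-sym x∈Z r∼x)) (proj₂ (∈-reps⁻ r∈)))

    length-classes : length Z ≡ sum (map (λ r → length (class r)) reps)
    length-classes = begin
      length Z                              ≡⟨ length-unique-≡ Z-unique classes-unique (mk⇔ to from) ⟩
      length (concat (map class reps))      ≡⟨ length-concat (map class reps) ⟩
      sum (map length (map class reps))     ≡⟨ cong sum (sym (map-∘ reps)) ⟩
      sum (map (λ r → length (class r)) reps) ∎
      where
      open ≡-Reasoning
      ∈-class⇒≡ : ∀ {r x} → x ∈ class r → rep x ≡ r
      ∈-class⇒≡ {r} = proj₂ ∘ ∈-filter⁻ (λ x → rep x ≟ r) {xs = Z}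
      classes-unique : Unique (concat (map class reps))
      classes-unique = Unique.concat⁺ (All.map⁺ (All.tabulate (λ {r} _ → class-unique r)))
        (AllPairs.map⁺ {f = class}
          (AllPairs.map (λ r≢r' {_} (x∈ , x∈') → r≢r' (trans (sym (∈-class⇒≡ x∈)) (∈-class⇒≡ x∈')))
                        reps-unique))
      to : ∀ {x} → x ∈ Z → x ∈ concat (map class reps)
      to x∈ = ∈-concat⁺′ (Equivalence.from (∈-class⇔ (rep-∈-reps x∈)) (x∈ , rep-∼ x∈))
                         (∈-map⁺ class (rep-∈-reps x∈))
      from : ∀ {x} → x ∈ concat (map class reps) → x ∈ Z
      from x∈ with ∈-concat⁻′ (map class reps) x∈
      ... | xs , x∈xs , xs∈ with ∈-map⁻ class xs∈
      ...   | r , _ , refl = proj₁ (∈-filter⁻ (λ x → rep x ≟ r) x∈xs)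

module FieldProperties (K : FiniteField) where

  open import Data.Product using (_×_; _,_; proj₁; proj₂)
  open import Data.Product.Properties using (≡-dec)
  open import Data.Sum using (_⊎_; inj₁; inj₂)
  open import Data.Empty using (⊥-elim)
  open import Data.List using (List)
  open import Data.List.Membership.Propositional using (_∈_; find; lose)
  open import Data.List.Relation.Unary.Any using (here; there; any?)
  open import Data.List.Relation.Unary.All as All using ()
  open import Data.List.Relation.Unary.AllPairs using (_∷_)
  open import Data.List.Relation.Unary.Unique.Propositional using (Unique)
  open import Algebra.Bundles using (CommutativeRing)
  import Algebra.Properties.Ring as RingProperties
  import Algebra.Properties.CommutativeSemigroup as CommutativeSemigroupProperties
  open import Function.Base using (_∘_)
  open import Relation.Binary using (DecidableEquality)
  open import Relation.Binary.PropositionalEquality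
  open import Relation.Nullary using (Dec; yes; no)
  open ≡-Reasoning

  open FiniteField K public

  commutativeRing : CommutativeRing _ _
  commutativeRing = record { isCommutativeRing = isCommutativeRing }

  open CommutativeRing commutativeRing public
    using (+-assoc; +-comm; +-identityˡ; +-identityʳ; *-assoc; *-comm; *-identityˡ; *-identityʳ;
           distribˡ; distribʳ; zeroˡ; zeroʳ; -‿inverseˡ; -‿inverseʳ)
  open CommutativeRing commutativeRing using (ring; +-commutativeSemigroup; *-commutativeSemigroup)
  open RingProperties ring public using (-1*x≈-x; +-inverseˡ-unique; x∙y⁻¹≈ε⇒x≈y; -‿involutive; -0#≈0#)
  open CommutativeSemigroupProperties +-commutativeSemigroup public using ()
    renaming (interchange to +-interchange)
  open CommutativeSemigroupProperties *-commutativeSemigroup public using ()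
    renaming (x∙yz≈y∙xz to x*yz≡y*xz; xy∙z≈xz∙y to xy*z≡xz*y)

  private
    ≟-∈ : ∀ {xs : List Carrier} → Unique xs → ∀ {x y} → x ∈ xs → y ∈ xs → Dec (x ≡ y)
    ≟-∈ u (here refl) (here refl) = yes refl
    ≟-∈ (x∉ ∷ u) (here refl) (there y∈) = no λ { refl → All.lookup x∉ y∈ refl }
    ≟-∈ (y∉ ∷ u) (there x∈) (here refl) = no λ { refl → All.lookup y∉ x∈ refl }
    ≟-∈ (_ ∷ u) (there x∈) (there y∈) = ≟-∈ u x∈ y∈

  _≟_ : DecidableEquality Carrier
  x ≟ y = ≟-∈ elements-unique (elements-complete x) (elements-complete y)

  SetCard⇒Dec : ∀ {S m} → SetCard K S m → ∀ x → Dec (S x)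
  SetCard⇒Dec {S} (xs , _ , xs⊆S , S⊆xs , _) x with any? (x ≟_) xs
  ... | yes ∃y with find ∃y
  ...   | y , y∈ , refl = yes (All.lookup xs⊆S y∈)
  SetCard⇒Dec (xs , _ , xs⊆S , S⊆xs , _) x | no ∄y = no λ x∈S → ∄y (lose (S⊆xs x x∈S) refl)

  _≟²_ : DecidableEquality (Carrier × Carrier)
  _≟²_ = ≡-dec _≟_ _≟_

  1≢0 : 1# ≢ 0#
  1≢0 = 0≢1 ∘ sym

  inv : (x : Carrier) → x ≢ 0# → Carrier
  inv x x≢0 = proj₁ (inverse x x≢0)

  inv-inverseʳ : ∀ x (x≢0 : x ≢ 0#) → x * inv x x≢0 ≡ 1#
  inv-inverseʳ x x≢0 = proj₂ (inverse x x≢0)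

  inv-inverseˡ : ∀ x (x≢0 : x ≢ 0#) → inv x x≢0 * x ≡ 1#
  inv-inverseˡ x x≢0 = trans (*-comm _ x) (inv-inverseʳ x x≢0)

  [x*y]*y⁻¹≡x : ∀ x y (y≢0 : y ≢ 0#) → (x * y) * inv y y≢0 ≡ x
  [x*y]*y⁻¹≡x x y y≢0 = trans (*-assoc x y _) (trans (cong (x *_) (inv-inverseʳ y y≢0)) (*-identityʳ x))

  [x*y⁻¹]*y≡x : ∀ x y (y≢0 : y ≢ 0#) → (x * inv y y≢0) * y ≡ x
  [x*y⁻¹]*y≡x x y y≢0 = trans (*-assoc x _ y) (trans (cong (x *_) (inv-inverseˡ y y≢0)) (*-identityʳ x))

  x*[x⁻¹*y]≡y : ∀ x (x≢0 : x ≢ 0#) y → x * (inv x x≢0 * y) ≡ y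
  x*[x⁻¹*y]≡y x x≢0 y = trans (sym (*-assoc x _ y)) (trans (cong (_* y) (inv-inverseʳ x x≢0)) (*-identityˡ y))

  inv-solveˡ : ∀ x {y z} (x≢0 : x ≢ 0#) → x * y ≡ z → y ≡ inv x x≢0 * z
  inv-solveˡ x {y} {z} x≢0 xy≡z = begin
    y                    ≡⟨ sym (*-identityˡ y) ⟩
    1# * y               ≡⟨ cong (_* y) (sym (inv-inverseˡ x x≢0)) ⟩
    (inv x x≢0 * x) * y  ≡⟨ *-assoc _ x y ⟩
    inv x x≢0 * (x * y)  ≡⟨ cong (inv x x≢0 *_) xy≡z ⟩
    inv x x≢0 * z        ∎

  inv-≢0 : ∀ x (x≢0 : x ≢ 0#) → inv x x≢0 ≢ 0#
  inv-≢0 x x≢0 x⁻¹≡0 = 1≢0 (trans (sym (inv-inverseʳ x x≢0)) (trans (cong (x *_) x⁻¹≡0) (zeroʳ x)))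

  *-cancelˡ : ∀ x {y z} → x ≢ 0# → x * y ≡ x * z → y ≡ z
  *-cancelˡ x {y} {z} x≢0 xy≡xz = trans (inv-solveˡ x x≢0 xy≡xz) (sym (inv-solveˡ x x≢0 refl))

  *-cancelʳ : ∀ x {y z} → x ≢ 0# → y * x ≡ z * x → y ≡ z
  *-cancelʳ x x≢0 yx≡zx = *-cancelˡ x x≢0 (trans (*-comm x _) (trans yx≡zx (*-comm _ x)))

  *-≢0 : ∀ {x y} → x ≢ 0# → y ≢ 0# → x * y ≢ 0#
  *-≢0 {x} x≢0 y≢0 xy≡0 = y≢0 (*-cancelˡ x x≢0 (trans xy≡0 (sym (zeroʳ x))))

  infixr 7 _•²_
  _•²_ : Carrier → Carrier × Carrier → Carrier × Carrier
  μ •² y = (μ * proj₁ y , μ * proj₂ y)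

  •²-assoc : ∀ μ ν y → μ •² (ν •² y) ≡ (μ * ν) •² y
  •²-assoc μ ν y = cong₂ _,_ (sym (*-assoc μ ν _)) (sym (*-assoc μ ν _))

  •²-identityˡ : ∀ y → 1# •² y ≡ y
  •²-identityˡ y = cong₂ _,_ (*-identityˡ _) (*-identityˡ _)

  •²-zeroˡ : ∀ y → 0# •² y ≡ (0# , 0#)
  •²-zeroˡ y = cong₂ _,_ (zeroˡ _) (zeroˡ _)

  ≢0²⇒component≢0 : ∀ {a b} → (a , b) ≢ (0# , 0#) → a ≢ 0# ⊎ b ≢ 0#
  ≢0²⇒component≢0 {a} {b} ab≢0 with a ≟ 0# | b ≟ 0#
  ... | yes refl | yes refl = ⊥-elim (ab≢0 refl)
  ... | no a≢0 | _ = inj₁ a≢0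
  ... | yes _ | no b≢0 = inj₂ b≢0

  •²-injective : ∀ {y} → y ≢ (0# , 0#) → ∀ {μ ν} → μ •² y ≡ ν •² y → μ ≡ ν
  •²-injective y≢0 μy≡νy with ≢0²⇒component≢0 y≢0
  ... | inj₁ y₁≢0 = *-cancelʳ _ y₁≢0 (cong proj₁ μy≡νy)
  ... | inj₂ y₂≢0 = *-cancelʳ _ y₂≢0 (cong proj₂ μy≡νy)

  •²-≡0⇒≡0 : ∀ {y} → y ≢ (0# , 0#) → ∀ {μ} → μ •² y ≡ (0# , 0#) → μ ≡ 0#
  •²-≡0⇒≡0 {y} y≢0 μy≡0 = •²-injective y≢0 (trans μy≡0 (sym (•²-zeroˡ y)))

  •²-≢0⇒≢0 : ∀ {μ y} → μ •² y ≢ (0# , 0#) → μ ≢ 0#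
  •²-≢0⇒≢0 {y = y} μy≢0 refl = μy≢0 (•²-zeroˡ y)

module LinearAlgebra (K : FiniteField) (F : Subfield K) {q : ℕ} (cardF : SetCard K (Subfield.mem F) q) where

  import Data.Nat as Nat
  open Nat using (ℕ; zero; suc; _≤_; _^_)
  open import Data.Nat.Properties using (≤-refl; ≤-trans; n≤1+n)
  open import Data.Product using (Σ; _×_; _,_; proj₁; proj₂)
  open import Data.Empty using (⊥-elim)
  open import Data.List using (List; []; _∷_; length; map; cartesianProductWith)
  open import Data.List.Properties using (length-map)
  open ListCounting using (length-cartesianProductWith; map⁺-∈)
  open import Data.List.Membership.Propositional using (_∈_; find; lose)
  open import Data.List.Membership.Propositional.Properties
    using (∈-map⁺; ∈-map⁻; ∈-cartesianProductWith⁺; ∈-cartesianProductWith⁻)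
  open import Data.List.Relation.Unary.Any using (here; any?)
  open import Data.List.Relation.Unary.All as All using ()
  open import Data.List.Relation.Unary.AllPairs using ([]; _∷_)
  open import Data.List.Relation.Unary.Unique.Propositional using (Unique)
  import Data.List.Relation.Unary.Unique.Propositional.Properties as Unique
  open import Data.Vec as Vec using (Vec; []; _∷_)
  open import Data.Vec.Properties using (∷-injective)
  open import Data.Vec.Relation.Unary.All as VAll using ([]; _∷_)
  import Data.Vec.Relation.Unary.All.Properties as VAll
  open import Function.Base using (_∘_)
  open import Function.Bundles using (mk⇔; Equivalence)
  open import Relation.Binary.PropositionalEquality
  open import Relation.Nullary using (¬_; Dec; yes; no)
  open ≡-Reasoning

  open FieldProperties K public
  open Subfield F public using (0∈; 1∈; neg-closed; inv-closed)
    renaming (mem to inF; +-closed to +-closedF; *-closed to *-closedF)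

  Flist : List Carrier
  Flist = proj₁ cardF

  Flist-unique : Unique Flist
  Flist-unique = proj₁ (proj₂ cardF)

  Flist-sound : All.All inF Flist
  Flist-sound = proj₁ (proj₂ (proj₂ cardF))

  Flist-complete : ∀ a → inF a → a ∈ Flist
  Flist-complete = proj₁ (proj₂ (proj₂ (proj₂ cardF)))

  length-Flist : length Flist ≡ q
  length-Flist = proj₂ (proj₂ (proj₂ (proj₂ cardF)))

  inF? : ∀ x → Dec (inF x)
  inF? = SetCard⇒Dec cardF

  -1∈F : inF (- 1#)
  -1∈F = neg-closed 1∈

  inv∈F : ∀ {x} (x≢0 : x ≢ 0#) → inF x → inF (inv x x≢0)
  inv∈F {x} x≢0 x∈F = inv-closed x∈F (inv-inverseʳ x x≢0)

  infix 4 _≐𝔽_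
  _≐𝔽_ : Carrier → Carrier → Set
  x ≐𝔽 y = _≐_ K F (_𝔽 K F x) (_𝔽 K F y)

  ≐-sym : ∀ {A B} → _≐_ K F A B → _≐_ K F B A
  ≐-sym A≐B z = mk⇔ (Equivalence.from (A≐B z)) (Equivalence.to (A≐B z))

  ∈-𝔽-self : ∀ a → _𝔽 K F a a
  ∈-𝔽-self a = 1# , 1∈ , sym (*-identityʳ a)

  𝔽-≐-scale : ∀ {a c ρ} → c ≡ a * ρ → inF ρ → ρ ≢ 0# → a ≐𝔽 c
  𝔽-≐-scale {a} {c} {ρ} c≡aρ ρ∈F ρ≢0 z = mk⇔ to from
    where
    to : _𝔽 K F a z → _𝔽 K F c z
    to (λ' , λ'∈F , refl) = inv ρ ρ≢0 * λ' , *-closedF (inv∈F ρ≢0 ρ∈F) λ'∈F , (begin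
      a * λ'                   ≡⟨ cong (_* λ') (sym ([x*y]*y⁻¹≡x a ρ ρ≢0)) ⟩
      ((a * ρ) * inv ρ ρ≢0) * λ' ≡⟨ *-assoc _ _ λ' ⟩
      (a * ρ) * (inv ρ ρ≢0 * λ') ≡⟨ cong (_* _) (sym c≡aρ) ⟩
      c * (inv ρ ρ≢0 * λ')     ∎)
    from : _𝔽 K F c z → _𝔽 K F a z
    from (λ' , λ'∈F , refl) = ρ * λ' , *-closedF ρ∈F λ'∈F , trans (cong (_* λ') c≡aρ) (*-assoc a ρ λ')

  linComb : ∀ {d} → Vec Carrier d → Vec Carrier d → Carrier
  linComb = combo K (KasSpace K) F

  AllF : ∀ {d} → Vec Carrier d → Set
  AllF = VAll.All inF

  Independent : ∀ {d} → Vec Carrier d → Set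
  Independent bs = ∀ cs → AllF cs → linComb cs bs ≡ 0# → VAll.All (_≡ 0#) cs

  InSpan : ∀ {d} → Vec Carrier d → Carrier → Set
  InSpan bs s = Σ _ λ cs → AllF cs × s ≡ linComb cs bs

  replicate0∈F : ∀ d → AllF (Vec.replicate d 0#)
  replicate0∈F zero = []
  replicate0∈F (suc d) = 0∈ ∷ replicate0∈F d

  linComb-replicate0 : ∀ {d} (bs : Vec Carrier d) → linComb (Vec.replicate d 0#) bs ≡ 0#
  linComb-replicate0 [] = refl
  linComb-replicate0 (b ∷ bs) = trans (cong₂ _+_ (zeroˡ b) (linComb-replicate0 bs)) (+-identityˡ 0#)

  map-*∈F : ∀ {d r} → inF r → {cs : Vec Carrier d} → AllF cs → AllF (Vec.map (r *_) cs)
  map-*∈F r∈F [] = []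
  map-*∈F r∈F (c∈F ∷ cs∈F) = *-closedF r∈F c∈F ∷ map-*∈F r∈F cs∈F

  linComb-map-* : ∀ {d} r (cs bs : Vec Carrier d) → linComb (Vec.map (r *_) cs) bs ≡ r * linComb cs bs
  linComb-map-* r [] [] = sym (zeroʳ r)
  linComb-map-* r (c ∷ cs) (b ∷ bs) =
    trans (cong₂ _+_ (*-assoc r c b) (linComb-map-* r cs bs)) (sym (distribˡ r _ _))

  zipWith-+∈F : ∀ {d} {cs ds : Vec Carrier d} → AllF cs → AllF ds → AllF (Vec.zipWith _+_ cs ds)
  zipWith-+∈F [] [] = []
  zipWith-+∈F (c∈F ∷ cs∈F) (d∈F ∷ ds∈F) = +-closedF c∈F d∈F ∷ zipWith-+∈F cs∈F ds∈F

  linComb-zipWith-+ : ∀ {d} (cs ds bs : Vec Carrier d) →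
    linComb (Vec.zipWith _+_ cs ds) bs ≡ linComb cs bs + linComb ds bs
  linComb-zipWith-+ [] [] [] = sym (+-identityˡ 0#)
  linComb-zipWith-+ (c ∷ cs) (d ∷ ds) (b ∷ bs) =
    trans (cong₂ _+_ (distribʳ b c d) (linComb-zipWith-+ cs ds bs)) (+-interchange _ _ _ _)

  linComb-closed : ∀ {S d} → IsFSubspace K F S → {cs bs : Vec Carrier d} →
    AllF cs → VAll.All S bs → S (linComb cs bs)
  linComb-closed S-sub [] [] = IsFSubspace.0∈U S-sub
  linComb-closed S-sub (c∈F ∷ cs∈F) (b∈S ∷ bs∈S) =
    IsFSubspace.+-closed S-sub (IsFSubspace.scale-closed S-sub c∈F b∈S) (linComb-closed S-sub cs∈F bs∈S)

  linComb-injective : ∀ {d} {bs : Vec Carrier d} → Independent bs →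
    ∀ {cs cs'} → AllF cs → AllF cs' → linComb cs bs ≡ linComb cs' bs → cs ≡ cs'
  linComb-injective {d} {bs} bs-indep {cs} {cs'} cs∈F cs'∈F cs≡cs' =
    differences≡0 cs cs' (bs-indep _ (zipWith-+∈F cs∈F (map-*∈F -1∈F cs'∈F)) (begin
      linComb (Vec.zipWith _+_ cs (Vec.map (- 1# *_) cs')) bs  ≡⟨ linComb-zipWith-+ cs _ bs ⟩
      linComb cs bs + linComb (Vec.map (- 1# *_) cs') bs
        ≡⟨ cong₂ _+_ cs≡cs' (linComb-map-* (- 1#) cs' bs) ⟩
      linComb cs' bs + - 1# * linComb cs' bs                  ≡⟨ cong (linComb cs' bs +_) (-1*x≈-x _) ⟩
      linComb cs' bs + - linComb cs' bs                       ≡⟨ -‿inverseʳ _ ⟩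
      0#                                                      ∎))
    where
    x+-1*y≡0⇒x≡y : ∀ {x y} → x + - 1# * y ≡ 0# → x ≡ y
    x+-1*y≡0⇒x≡y {x} {y} e = x∙y⁻¹≈ε⇒x≈y x y (trans (cong (x +_) (sym (-1*x≈-x y))) e)
    differences≡0 : ∀ {d} (cs cs' : Vec Carrier d) →
      VAll.All (_≡ 0#) (Vec.zipWith _+_ cs (Vec.map (- 1# *_) cs')) → cs ≡ cs'
    differences≡0 [] [] [] = refl
    differences≡0 (c ∷ cs) (c' ∷ cs') (e ∷ es) = cong₂ _∷_ (x+-1*y≡0⇒x≡y e) (differences≡0 cs cs' es)

  Fvecs : ∀ d → List (Vec Carrier d)
  Fvecs zero = [] ∷ []
  Fvecs (suc d) = cartesianProductWith _∷_ Flist (Fvecs d)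

  ∈-Fvecs⁺ : ∀ {d} {cs : Vec Carrier d} → AllF cs → cs ∈ Fvecs d
  ∈-Fvecs⁺ [] = here refl
  ∈-Fvecs⁺ (c∈F ∷ cs∈F) = ∈-cartesianProductWith⁺ _∷_ (Flist-complete _ c∈F) (∈-Fvecs⁺ cs∈F)

  ∈-Fvecs⁻ : ∀ {d} {cs : Vec Carrier d} → cs ∈ Fvecs d → AllF cs
  ∈-Fvecs⁻ {zero} {[]} _ = []
  ∈-Fvecs⁻ {suc d} cs∈ with ∈-cartesianProductWith⁻ _∷_ Flist (Fvecs d) cs∈
  ... | c , cs , c∈ , cs∈' , refl = All.lookup Flist-sound c∈ ∷ ∈-Fvecs⁻ cs∈'

  Fvecs-unique : ∀ d → Unique (Fvecs d)
  Fvecs-unique zero = All.[] ∷ []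
  Fvecs-unique (suc d) = Unique.cartesianProductWith⁺ _∷_ ∷-injective Flist-unique (Fvecs-unique d)

  length-Fvecs : ∀ d → length (Fvecs d) ≡ q ^ d
  length-Fvecs zero = refl
  length-Fvecs (suc d) =
    trans (length-cartesianProductWith _∷_ Flist (Fvecs d)) (cong₂ Nat._*_ length-Flist (length-Fvecs d))

  inSpan? : ∀ {d} (bs : Vec Carrier d) s → Dec (InSpan bs s)
  inSpan? {d} bs s with any? (λ cs → s ≟ linComb cs bs) (Fvecs d)
  ... | yes ∃cs with find ∃cs
  ...   | cs , cs∈ , s≡ = yes (cs , ∈-Fvecs⁻ cs∈ , s≡)
  inSpan? {d} bs s | no ∄cs = no λ (cs , cs∈F , s≡) → ∄cs (lose (∈-Fvecs⁺ cs∈F) s≡)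

  HasDim⇒SetCard : ∀ {S d} → IsFSubspace K F S → HasDim K (KasSpace K) F S d → SetCard K S (q ^ d)
  HasDim⇒SetCard {S} {d} S-sub (bs , bs∈S , spanning , bs-indep) =
    map (λ cs → linComb cs bs) (Fvecs d) ,
    map⁺-∈ _ (Fvecs-unique d) (λ cs∈ cs'∈ → linComb-injective bs-indep (∈-Fvecs⁻ cs∈) (∈-Fvecs⁻ cs'∈)) ,
    All.tabulate sound ,
    complete ,
    trans (length-map _ (Fvecs d)) (length-Fvecs d)
    where
    sound : ∀ {s} → s ∈ map (λ cs → linComb cs bs) (Fvecs d) → S s
    sound s∈ with ∈-map⁻ _ s∈
    ... | cs , cs∈ , refl = linComb-closed S-sub (∈-Fvecs⁻ cs∈) bs∈S
    complete : ∀ s → S s → s ∈ map (λ cs → linComb cs bs) (Fvecs d)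
    complete s s∈S with spanning s s∈S
    ... | cs , cs∈F , refl = ∈-map⁺ _ (∈-Fvecs⁺ cs∈F)

  HasDim-suc⇒nonzero : ∀ {S d} → HasDim K (KasSpace K) F S (suc d) → Σ Carrier λ x → S x × x ≢ 0#
  HasDim-suc⇒nonzero {d = d} (b ∷ bs , b∈S ∷ _ , _ , indep) = b , b∈S , λ b≡0 →
    1≢0 (VAll.head (indep (1# ∷ Vec.replicate d 0#) (1∈ ∷ replicate0∈F d)
      (trans (cong₂ _+_ (trans (*-identityˡ b) b≡0) (linComb-replicate0 bs)) (+-identityˡ 0#))))

  inSpan-∷ : ∀ {d} {bs : Vec Carrier d} {s} z → InSpan bs s → InSpan (z ∷ bs) s
  inSpan-∷ {bs = bs} z (cs , cs∈F , refl) =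
    0# ∷ cs , 0∈ ∷ cs∈F , sym (trans (cong (_+ linComb cs bs) (zeroˡ z)) (+-identityˡ _))

  inSpan-head : ∀ {d} (bs : Vec Carrier d) z → InSpan (z ∷ bs) z
  inSpan-head {d} bs z = 1# ∷ Vec.replicate d 0# , 1∈ ∷ replicate0∈F d ,
    sym (trans (cong₂ _+_ (*-identityˡ z) (linComb-replicate0 bs)) (+-identityʳ z))

  independent-∷ : ∀ {d} {bs : Vec Carrier d} z → Independent bs → ¬ InSpan bs z → Independent (z ∷ bs)
  independent-∷ {bs = bs} z bs-indep z∉span (c ∷ cs) (c∈F ∷ cs∈F) ≡0 with c ≟ 0#
  ... | yes refl = refl ∷ bs-indep cs cs∈F
                            (trans (sym (+-identityˡ _)) (trans (cong (_+ linComb cs bs) (sym (zeroˡ z))) ≡0))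
  ... | no c≢0 = ⊥-elim (z∉span (Vec.map (r *_) cs , map-*∈F r∈F cs∈F , z≡))
    where
    r : Carrier
    r = inv c c≢0 * - 1#
    r∈F : inF r
    r∈F = *-closedF (inv∈F c≢0 c∈F) -1∈F
    z≡ : z ≡ linComb (Vec.map (r *_) cs) bs
    z≡ = begin
      z                                  ≡⟨ inv-solveˡ c c≢0 (+-inverseˡ-unique _ _ ≡0) ⟩
      inv c c≢0 * - linComb cs bs        ≡⟨ cong (inv c c≢0 *_) (sym (-1*x≈-x _)) ⟩
      inv c c≢0 * (- 1# * linComb cs bs) ≡⟨ sym (*-assoc _ _ _) ⟩
      r * linComb cs bs                  ≡⟨ sym (linComb-map-* r cs bs) ⟩
      linComb (Vec.map (r *_) cs) bs     ∎

  independent-∉F∷1 : ∀ {ρ} → ¬ inF ρ → Independent (ρ ∷ 1# ∷ [])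
  independent-∉F∷1 {ρ} ρ∉F = independent-∷ ρ independent-[1] ρ∉span
    where
    c*1+0≡c : ∀ c → linComb (c ∷ []) (1# ∷ []) ≡ c
    c*1+0≡c c = trans (+-identityʳ _) (*-identityʳ c)
    independent-[1] : Independent (1# ∷ [])
    independent-[1] (c ∷ []) _ ≡0 = trans (sym (c*1+0≡c c)) ≡0 ∷ []
    ρ∉span : ¬ InSpan (1# ∷ []) ρ
    ρ∉span (c ∷ [] , c∈F ∷ [] , ρ≡) = ρ∉F (subst inF (sym (trans ρ≡ (c*1+0≡c c))) c∈F)

  private
    Extension : (Carrier → Set) → ∀ {d} → Vec Carrier d → List Carrier → Set
    Extension T {d} bs L = Σ ℕ λ d' → Σ (Vec Carrier d') λ bs' →
      d ≤ d' × VAll.All T bs' × Independent bs' ×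
      (∀ {s} → InSpan bs s → InSpan bs' s) × All.All (InSpan bs') L

    extend : ∀ {T d} (L : List Carrier) → All.All T L →
      (bs : Vec Carrier d) → VAll.All T bs → Independent bs → Extension T bs L
    extend [] _ bs bs∈T bs-indep = _ , bs , ≤-refl , bs∈T , bs-indep , (λ s∈ → s∈) , All.[]
    extend (z ∷ L) (z∈T All.∷ L∈T) bs bs∈T bs-indep with inSpan? bs z
    ... | yes z∈span =
      let d' , bs' , d≤d' , bs'∈T , bs'-indep , ⊆span , L∈span = extend L L∈T bs bs∈T bs-indep
      in d' , bs' , d≤d' , bs'∈T , bs'-indep , ⊆span , ⊆span z∈span All.∷ L∈span
    ... | no z∉span =
      let d' , bs' , d≤d' , bs'∈T , bs'-indep , ⊆span , L∈span =
            extend L L∈T (z ∷ bs) (z∈T ∷ bs∈T) (independent-∷ z bs-indep z∉span)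
      in d' , bs' , ≤-trans (n≤1+n _) d≤d' , bs'∈T , bs'-indep , ⊆span ∘ inSpan-∷ z ,
         ⊆span (inSpan-head bs z) All.∷ L∈span

  extend-to-basis : ∀ {T d} (L : List Carrier) → All.All T L → (∀ v → T v → v ∈ L) →
    (bs : Vec Carrier d) → VAll.All T bs → Independent bs →
    Σ ℕ λ d' → d ≤ d' × HasDim K (KasSpace K) F T d'
  extend-to-basis L L∈T T⊆L bs bs∈T bs-indep =
    let d' , bs' , d≤d' , bs'∈T , bs'-indep , _ , L∈span = extend L L∈T bs bs∈T bs-indep
    in d' , d≤d' , bs' , bs'∈T , (λ v v∈T → All.lookup L∈span (T⊆L v v∈T)) , bs'-indep

  linComb² : ∀ {d} → Vec Carrier d → Vec (Carrier × Carrier) d → Carrier × Carrier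
  linComb² = combo K (K²Space K) F

  linComb²-map-•² : ∀ {d} (cs bs : Vec Carrier d) y → linComb² cs (Vec.map (_•² y) bs) ≡ linComb cs bs •² y
  linComb²-map-•² [] [] y = sym (•²-zeroˡ y)
  linComb²-map-•² (c ∷ cs) (b ∷ bs) (y₁ , y₂) rewrite linComb²-map-•² cs bs (y₁ , y₂) =
    cong₂ _,_ (step y₁) (step y₂)
    where
    step : ∀ yᵢ → c * (b * yᵢ) + linComb cs bs * yᵢ ≡ (c * b + linComb cs bs) * yᵢ
    step yᵢ = trans (cong (_+ linComb cs bs * yᵢ) (sym (*-assoc c b yᵢ))) (sym (distribʳ yᵢ (c * b) _))

  linComb²-replicate0 : ∀ {d} (bs : Vec (Carrier × Carrier) d) → linComb² (Vec.replicate d 0#) bs ≡ (0# , 0#)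
  linComb²-replicate0 [] = refl
  linComb²-replicate0 ((b₁ , b₂) ∷ bs) rewrite linComb²-replicate0 bs =
    cong₂ _,_ (trans (cong (_+ 0#) (zeroˡ b₁)) (+-identityˡ 0#))
              (trans (cong (_+ 0#) (zeroˡ b₂)) (+-identityˡ 0#))

  independent²-pair : ∀ {d} {b₁ b₂} {bs : Vec (Carrier × Carrier) d} →
    (∀ cs → AllF cs → linComb² cs (b₁ ∷ b₂ ∷ bs) ≡ (0# , 0#) → VAll.All (_≡ 0#) cs) →
    ∀ {λ' μ} → inF λ' → inF μ → λ' •² b₁ ≡ μ •² b₂ → λ' ≡ 0# × μ ≡ 0#
  independent²-pair {d} {b₁} {b₂} {bs} indep {λ'} {μ} λ'∈F μ∈F λ'b₁≡μb₂ =
    VAll.head coefficients≡0 ,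
    trans (sym (-‿involutive μ)) (trans (cong -_ (VAll.head (VAll.tail coefficients≡0))) -0#≈0#)
    where
    cancel : ∀ {x} r → x ≡ μ * r → x + (- μ * r + 0#) ≡ 0#
    cancel {x} r refl = begin
      μ * r + (- μ * r + 0#)  ≡⟨ cong (μ * r +_) (+-identityʳ _) ⟩
      μ * r + - μ * r         ≡⟨ sym (distribʳ r μ (- μ)) ⟩
      (μ + - μ) * r           ≡⟨ cong (_* r) (-‿inverseʳ μ) ⟩
      0# * r                  ≡⟨ zeroˡ r ⟩
      0#                      ∎
    combination≡0 : linComb² (λ' ∷ - μ ∷ Vec.replicate d 0#) (b₁ ∷ b₂ ∷ bs) ≡ (0# , 0#)
    combination≡0 rewrite linComb²-replicate0 bs =
      cong₂ _,_ (cancel (proj₁ b₂) (cong proj₁ λ'b₁≡μb₂)) (cancel (proj₂ b₂) (cong proj₂ λ'b₁≡μb₂))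
    coefficients≡0 : VAll.All (_≡ 0#) (λ' ∷ - μ ∷ Vec.replicate d 0#)
    coefficients≡0 =
      indep (λ' ∷ - μ ∷ Vec.replicate d 0#) (λ'∈F ∷ neg-closed μ∈F ∷ replicate0∈F d) combination≡0

  HasDim-•² : ∀ {T : Carrier → Set} {S : Carrier × Carrier → Set} {w} y → y ≢ (0# , 0#) →
    (∀ z → S z → Σ Carrier λ μ → T μ × z ≡ μ •² y) → (∀ μ → T μ → S (μ •² y)) →
    HasDim K (KasSpace K) F T w → HasDim K (K²Space K) F S w
  HasDim-•² y y≢0 S⊆T•y T•y⊆S (bs , bs∈T , spanning , bs-indep) =
    Vec.map (_•² y) bs ,
    VAll.map⁺ (VAll.map (T•y⊆S _) bs∈T) ,
    (λ z z∈S → let μ , μ∈T , z≡ = S⊆T•y z z∈S ; cs , cs∈F , μ≡ = spanning μ μ∈T in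
       cs , cs∈F , trans z≡ (trans (cong (_•² y) μ≡) (sym (linComb²-map-•² cs bs y)))) ,
    (λ cs cs∈F ≡0 → bs-indep cs cs∈F (•²-≡0⇒≡0 y≢0 (trans (sym (linComb²-map-•² cs bs y)) ≡0)))

module ProjectiveLine (K : FiniteField) (F : Subfield K) {q : ℕ} (cardF : SetCard K (Subfield.mem F) q) where

  open import Data.Nat using (suc)
  open import Data.Product using (Σ; _×_; _,_; proj₁; proj₂)
  open import Data.Empty using (⊥-elim)
  open import Data.List using (List; _∷_; length; map; cartesianProduct)
  open import Data.List.Properties using (length-map)
  open import Data.List.Membership.Propositional using (_∈_; find; lose)
  open import Data.List.Membership.Propositional.Properties
    using (∈-map⁺; ∈-map⁻; ∈-cartesianProduct⁺; ∈-cartesianProduct⁻)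
  open import Data.List.Relation.Unary.Any using (here; there; any?)
  open import Data.List.Relation.Unary.All as All using ()
  open import Data.List.Relation.Unary.AllPairs using (_∷_)
  open import Data.List.Relation.Unary.Unique.Propositional using (Unique)
  import Data.List.Relation.Unary.Unique.Propositional.Properties as Unique
  open import Data.Product.Properties using (,-injectiveʳ)
  open import Function.Base using (_∘_)
  open import Function.Bundles using (mk⇔; Equivalence)
  open import Relation.Binary.PropositionalEquality
  open import Relation.Nullary using (Dec; yes; no; ¬?)
  open import Relation.Nullary.Decidable using (_×-dec_)
  open ≡-Reasoning

  open LinearAlgebra K F cardF public

  K² : Set
  K² = Carrier × Carrier

  infix 4 _∼_
  _∼_ : K² → K² → Set
  x ∼ y = Σ Carrier λ μ → y ≡ μ •² x

  ∼-refl : ∀ x → x ∼ x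
  ∼-refl x = 1# , sym (•²-identityˡ x)

  ∼-trans : ∀ {x y z} → x ∼ y → y ∼ z → x ∼ z
  ∼-trans {x} (μ , refl) (ν , refl) = ν * μ , •²-assoc ν μ x

  ∼-sym : ∀ {x y} → y ≢ (0# , 0#) → x ∼ y → y ∼ x
  ∼-sym {x} y≢0 (μ , refl) = inv μ μ≢0 , (begin
    x                         ≡⟨ sym (•²-identityˡ x) ⟩
    1# •² x                   ≡⟨ cong (_•² x) (sym (inv-inverseˡ μ μ≢0)) ⟩
    (inv μ μ≢0 * μ) •² x      ≡⟨ sym (•²-assoc _ μ x) ⟩
    inv μ μ≢0 •² (μ •² x)     ∎)
    where
    μ≢0 : μ ≢ 0#
    μ≢0 = •²-≢0⇒≢0 y≢0

  _∼?_ : ∀ x y → Dec (x ∼ y)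
  x ∼? y with any? (λ μ → y ≟² (μ •² x)) elements
  ... | yes ∃μ with find ∃μ
  ...   | μ , _ , y≡ = yes (μ , y≡)
  x ∼? y | no ∄μ = no λ (μ , y≡) → ∄μ (lose (elements-complete μ) y≡)

  ∼⇒⟨⟩≐ : ∀ {x y} → y ≢ (0# , 0#) → x ∼ y → _≐²_ K F (⟨_⟩ K F x) (⟨_⟩ K F y)
  ∼⇒⟨⟩≐ y≢0 x∼y z = mk⇔ (∼-trans (∼-sym y≢0 x∼y)) (∼-trans x∼y)

  ⟨⟩≐⇒∼ : ∀ {x y} → _≐²_ K F (⟨_⟩ K F x) (⟨_⟩ K F y) → x ∼ y
  ⟨⟩≐⇒∼ {x} {y} x≐y = Equivalence.from (x≐y y) (∼-refl y)

  ≐²-trans : ∀ {A B C} → _≐²_ K F A B → _≐²_ K F B C → _≐²_ K F A C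
  ≐²-trans A≐B B≐C z = mk⇔ (Equivalence.to (B≐C z) ∘ Equivalence.to (A≐B z))
                           (Equivalence.from (A≐B z) ∘ Equivalence.from (B≐C z))

  IsFVector : K² → Set
  IsFVector c = inF (proj₁ c) × inF (proj₂ c) × c ≢ (0# , 0#)

  IsFPoint : K² → Set
  IsFPoint v = Σ K² λ c → IsFVector c × c ∼ v

  IsFPoint? : ∀ v → Dec (IsFPoint v)
  IsFPoint? v with any? (λ c → ¬? (c ≟² (0# , 0#)) ×-dec (c ∼? v)) (cartesianProduct Flist Flist)
  ... | yes ∃c with find ∃c
  ...   | c , c∈ , c≢0 , c∼v = let c₁∈ , c₂∈ = ∈-cartesianProduct⁻ Flist Flist c∈ in
          yes (c , (All.lookup Flist-sound c₁∈ , All.lookup Flist-sound c₂∈ , c≢0) , c∼v)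
  IsFPoint? v | no ∄c = no λ (c , (c₁∈F , c₂∈F , c≢0) , c∼v) →
    ∄c (lose (∈-cartesianProduct⁺ (Flist-complete _ c₁∈F) (Flist-complete _ c₂∈F)) (c≢0 , c∼v))

  IsFPoint-∼ : ∀ {x y} → IsFPoint x → x ∼ y → IsFPoint y
  IsFPoint-∼ (c , c∈F² , c∼x) x∼y = c , c∈F² , ∼-trans c∼x x∼y

  InPGFq⇒IsFPoint : ∀ {v} → InPGFq K F v → IsFPoint v
  InPGFq⇒IsFPoint (c , c₁∈F , c₂∈F , c≢0 , c≐v) = c , (c₁∈F , c₂∈F , c≢0) , ⟨⟩≐⇒∼ c≐v

  IsFPoint⇒InPGFq : ∀ {v} → v ≢ (0# , 0#) → IsFPoint v → InPGFq K F v
  IsFPoint⇒InPGFq v≢0 (c , (c₁∈F , c₂∈F , c≢0) , c∼v) = c , c₁∈F , c₂∈F , c≢0 , ∼⇒⟨⟩≐ v≢0 c∼v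

  IsFPoint⇒ratio : ∀ {x₁ x₂} → IsFPoint (x₁ , x₂) → x₁ ≢ 0# → Σ Carrier λ σ → inF σ × x₂ ≡ x₁ * σ
  IsFPoint⇒ratio {x₁} {x₂} ((c₁ , c₂) , (c₁∈F , c₂∈F , _) , μ , x≡μc) x₁≢0 =
    σ , *-closedF (inv∈F c₁≢0 c₁∈F) c₂∈F , (begin
      x₂                            ≡⟨ cong proj₂ x≡μc ⟩
      μ * c₂                        ≡⟨ cong (_* c₂) (sym ([x*y]*y⁻¹≡x μ c₁ c₁≢0)) ⟩
      ((μ * c₁) * inv c₁ c₁≢0) * c₂ ≡⟨ *-assoc _ _ c₂ ⟩
      (μ * c₁) * σ                  ≡⟨ cong (_* σ) (sym (cong proj₁ x≡μc)) ⟩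
      x₁ * σ                        ∎)
    where
    c₁≢0 : c₁ ≢ 0#
    c₁≢0 c₁≡0 = x₁≢0 (trans (cong proj₁ x≡μc) (trans (cong (μ *_) c₁≡0) (zeroʳ μ)))
    σ : Carrier
    σ = inv c₁ c₁≢0 * c₂

  ratio⇒IsFPoint : ∀ {x₁ x₂ σ} → inF σ → x₂ ≡ x₁ * σ → IsFPoint (x₁ , x₂)
  ratio⇒IsFPoint {x₁} {σ = σ} σ∈F refl =
    (1# , σ) , (1∈ , σ∈F , 1≢0 ∘ cong proj₁) , x₁ , cong (_, x₁ * σ) (sym (*-identityʳ x₁))

  second-axis-IsFPoint : ∀ x₂ → IsFPoint (0# , x₂)
  second-axis-IsFPoint x₂ =
    (0# , 1#) , (0∈ , 1∈ , 1≢0 ∘ cong proj₂) , x₂ , cong₂ _,_ (sym (zeroʳ x₂)) (sym (*-identityʳ x₂))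

  canonicalPoints : List K²
  canonicalPoints = (0# , 1#) ∷ map (1# ,_) Flist

  length-canonicalPoints : length canonicalPoints ≡ suc q
  length-canonicalPoints = cong suc (trans (length-map (1# ,_) Flist) length-Flist)

  canonicalPoints-unique : Unique canonicalPoints
  canonicalPoints-unique = All.tabulate first∉ ∷ Unique.map⁺ ,-injectiveʳ Flist-unique
    where
    first∉ : ∀ {c} → c ∈ map (1# ,_) Flist → (0# , 1#) ≢ c
    first∉ c∈ 01≡c with ∈-map⁻ (1# ,_) c∈
    ... | _ , _ , refl = 0≢1 (cong proj₁ 01≡c)

  canonicalPoints-IsFVector : ∀ {c} → c ∈ canonicalPoints → IsFVector c
  canonicalPoints-IsFVector (here refl) = 0∈ , 1∈ , 1≢0 ∘ cong proj₂
  canonicalPoints-IsFVector (there c∈) with ∈-map⁻ (1# ,_) c∈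
  ... | l , l∈ , refl = 1∈ , All.lookup Flist-sound l∈ , 1≢0 ∘ cong proj₁

  canonicalPoints-∼-injective : ∀ {c c'} → c ∈ canonicalPoints → c' ∈ canonicalPoints → c ∼ c' → c ≡ c'
  canonicalPoints-∼-injective (here refl) (here refl) _ = refl
  canonicalPoints-∼-injective (here refl) (there c'∈) (μ , c'≡) with ∈-map⁻ (1# ,_) c'∈
  ... | _ , _ , refl = ⊥-elim (1≢0 (trans (cong proj₁ c'≡) (zeroʳ μ)))
  canonicalPoints-∼-injective (there c∈) (here refl) (μ , c'≡) with ∈-map⁻ (1# ,_) c∈
  ... | l , _ , refl = ⊥-elim (1≢0 (begin
    1#      ≡⟨ cong proj₂ c'≡ ⟩
    μ * l   ≡⟨ cong (_* l) μ≡0 ⟩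
    0# * l  ≡⟨ zeroˡ l ⟩
    0#      ∎))
    where μ≡0 = trans (sym (*-identityʳ μ)) (sym (cong proj₁ c'≡))
  canonicalPoints-∼-injective (there c∈) (there c'∈) (μ , c'≡) with ∈-map⁻ (1# ,_) c∈ | ∈-map⁻ (1# ,_) c'∈
  ... | l , _ , refl | l' , _ , refl = cong (1# ,_) (sym (begin
    l'      ≡⟨ cong proj₂ c'≡ ⟩
    μ * l   ≡⟨ cong (_* l) μ≡1 ⟩
    1# * l  ≡⟨ *-identityˡ l ⟩
    l       ∎))
    where μ≡1 = trans (sym (*-identityʳ μ)) (sym (cong proj₁ c'≡))

  IsFPoint⇒canonical : ∀ {v} → IsFPoint v → Σ K² λ c → c ∈ canonicalPoints × c ∼ v
  IsFPoint⇒canonical ((c₁ , c₂) , (c₁∈F , c₂∈F , c≢0) , c∼v) with c₁ ≟ 0#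
  ... | yes refl = (0# , 1#) , here refl ,
        ∼-trans (c₂ , cong₂ _,_ (sym (zeroʳ c₂)) (sym (*-identityʳ c₂))) c∼v
  ... | no c₁≢0 = (1# , l) , there (∈-map⁺ (1# ,_) (Flist-complete l l∈F)) ,
        ∼-trans (c₁ , cong₂ _,_ (sym (*-identityʳ c₁)) (sym (x*[x⁻¹*y]≡y c₁ c₁≢0 c₂))) c∼v
    where
    l : Carrier
    l = inv c₁ c₁≢0 * c₂
    l∈F : inF l
    l∈F = *-closedF (inv∈F c₁≢0 c₁∈F) c₂∈F

module SidonSpaces
  (K : FiniteField) (F : Subfield K) {q : ℕ} (cardF : SetCard K (Subfield.mem F) q)
  (U : FiniteField.Carrier K → Set) (U-subspace : IsFSubspace K F U)
  {k : ℕ} (U-dim : HasDim K (KasSpace K) F U k)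
  where

  open import Data.Nat using (ℕ; zero; suc; _^_; _<_; s≤s)
  open import Data.Product using (Σ; _×_; _,_; proj₁; proj₂)
  open import Data.Sum using (_⊎_; inj₁; inj₂)
  open import Data.Empty using (⊥-elim)
  open import Data.List using (filter)
  open import Data.List.Membership.Propositional.Properties using (∈-filter⁺)
  open import Data.List.Relation.Unary.All.Properties using (all-filter)
  open import Data.Vec using ([]; _∷_)
  open import Data.Vec.Relation.Unary.All using ([]; _∷_)
  open import Function.Base using (_∘_)
  open import Function.Bundles using (_⇔_; mk⇔; Equivalence)
  open import Relation.Binary.PropositionalEquality
  open import Relation.Nullary using (¬_; Dec; yes; no)
  open import Relation.Nullary.Decidable using (_×-dec_)
  open ≡-Reasoning

  open ProjectiveLine K F cardF public
  open IsFSubspace U-subspace public using (0∈U; scale-closed)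

  W : K² → Set
  W = _×ˢ_ K F U U

  U-card : SetCard K U (q ^ k)
  U-card = HasDim⇒SetCard U-subspace U-dim

  W? : ∀ x → Dec (W x)
  W? (x₁ , x₂) = SetCard⇒Dec U-card x₁ ×-dec SetCard⇒Dec U-card x₂

  scale-closedʳ : ∀ {λ' x} → inF λ' → U x → U (x * λ')
  scale-closedʳ {λ'} {x} λ'∈F x∈U = subst U (*-comm λ' x) (scale-closed λ'∈F x∈U)

  •²-∈W⇔ : ∀ {c} → IsFVector c → ∀ ν → W (ν •² c) ⇔ U ν
  •²-∈W⇔ {c₁ , c₂} (c₁∈F , c₂∈F , c≢0) ν = mk⇔ to (λ ν∈U → scale-closedʳ c₁∈F ν∈U , scale-closedʳ c₂∈F ν∈U)
    where
    to : W (ν •² (c₁ , c₂)) → U ν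
    to (νc₁∈U , νc₂∈U) with ≢0²⇒component≢0 c≢0
    ... | inj₁ c₁≢0 = subst U ([x*y]*y⁻¹≡x ν c₁ c₁≢0) (scale-closedʳ (inv∈F c₁≢0 c₁∈F) νc₁∈U)
    ... | inj₂ c₂≢0 = subst U ([x*y]*y⁻¹≡x ν c₂ c₂≢0) (scale-closedʳ (inv∈F c₂≢0 c₂∈F) νc₂∈U)

  InPGFq⇒weight-k : ∀ v → InPGFq K F v → Weight K F W v k
  InPGFq⇒weight-k v (c , c₁∈F , c₂∈F , c≢0 , c≐v) =
    HasDim-•² c c≢0 ∩⟨v⟩⊆U•c U•c⊆∩⟨v⟩ U-dim
    where
    c∈F² : IsFVector c
    c∈F² = c₁∈F , c₂∈F , c≢0
    ∩⟨v⟩⊆U•c : ∀ z → _∩⟨_⟩ K F W v z → Σ Carrier λ ν → U ν × z ≡ ν •² c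
    ∩⟨v⟩⊆U•c z (z∈W , z∈⟨v⟩) with Equivalence.from (c≐v z) z∈⟨v⟩
    ... | ν , refl = ν , Equivalence.to (•²-∈W⇔ c∈F² ν) z∈W , refl
    U•c⊆∩⟨v⟩ : ∀ ν → U ν → _∩⟨_⟩ K F W v (ν •² c)
    U•c⊆∩⟨v⟩ ν ν∈U = Equivalence.from (•²-∈W⇔ c∈F² ν) ν∈U , Equivalence.to (c≐v _) (ν , refl)

  Sidon⇒scalar∈F⊎IsFPoint : IsSidon K F U → ∀ {x λ'} → W x → W (λ' •² x) → λ' ≢ 0# → inF λ' ⊎ IsFPoint x
  Sidon⇒scalar∈F⊎IsFPoint sidon {x₁ , x₂} {λ'} (x₁∈U , x₂∈U) (λ'x₁∈U , λ'x₂∈U) λ'≢0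
    with x₁ ≟ 0# | x₂ ≟ 0#
  ... | yes refl | _ = inj₂ (second-axis-IsFPoint x₂)
  ... | no _ | yes refl = inj₂ (ratio⇒IsFPoint 0∈ (sym (zeroʳ x₁)))
  ... | no x₁≢0 | no x₂≢0
    with sidon x₁ (λ' * x₂) (λ' * x₁) x₂ x₁∈U λ'x₂∈U λ'x₁∈U x₂∈U
                x₁≢0 (*-≢0 λ'≢0 x₂≢0) (*-≢0 λ'≢0 x₁≢0) x₂≢0
                (trans (x*yz≡y*xz x₁ λ' x₂) (sym (*-assoc λ' x₁ x₂)))
  ... | inj₁ (x₁𝔽≐λ'x₁𝔽 , _) =
    let l , l∈F , λ'x₁≡x₁l = Equivalence.from (x₁𝔽≐λ'x₁𝔽 (λ' * x₁)) (∈-𝔽-self (λ' * x₁))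
    in inj₁ (subst inF (sym (*-cancelʳ x₁ x₁≢0 (trans λ'x₁≡x₁l (*-comm x₁ l)))) l∈F)
  ... | inj₂ (x₁𝔽≐x₂𝔽 , _) =
    let l , l∈F , x₂≡x₁l = Equivalence.from (x₁𝔽≐x₂𝔽 x₂) (∈-𝔽-self x₂)
    in inj₂ (ratio⇒IsFPoint l∈F x₂≡x₁l)

  Sidon⇒weight>1⇒InPGFq : IsSidon K F U → ∀ v → v ≢ (0# , 0#) →
    (Σ ℕ λ w → Weight K F W v w × 1 < w) → InPGFq K F v
  Sidon⇒weight>1⇒InPGFq _ _ _ (zero , _ , ())
  Sidon⇒weight>1⇒InPGFq _ _ _ (suc zero , _ , s≤s ())
  Sidon⇒weight>1⇒InPGFq sidon v v≢0
    (suc (suc _) , (b₁ ∷ b₂ ∷ _ , (b₁∈W , α , b₁≡αv) ∷ (b₂∈W , β , b₂≡βv) ∷ _ , _ , indep) , _) =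
    IsFPoint⇒InPGFq v≢0 (conclude (Sidon⇒scalar∈F⊎IsFPoint sidon b₁∈W (subst W b₂≡λb₁ b₂∈W) λ≢0))
    where
    α≢0 : α ≢ 0#
    α≢0 refl = 1≢0 (proj₁ (independent²-pair indep 1∈ 0∈
      (trans (•²-identityˡ b₁) (trans b₁≡αv
        (trans (•²-zeroˡ v) (sym (trans (cong (0# •²_) b₂≡βv) (•²-zeroˡ _))))))))
    β≢0 : β ≢ 0#
    β≢0 refl = 1≢0 (proj₂ (independent²-pair indep 0∈ 1∈
      (trans (•²-zeroˡ b₁) (sym (trans (•²-identityˡ b₂) (trans b₂≡βv (•²-zeroˡ v)))))))
    λ' : Carrier
    λ' = β * inv α α≢0
    λ≢0 : λ' ≢ 0#
    λ≢0 = *-≢0 β≢0 (inv-≢0 α α≢0)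
    b₂≡λb₁ : b₂ ≡ λ' •² b₁
    b₂≡λb₁ = begin
      b₂                   ≡⟨ b₂≡βv ⟩
      β •² v               ≡⟨ cong (_•² v) (sym ([x*y⁻¹]*y≡x β α α≢0)) ⟩
      (λ' * α) •² v        ≡⟨ sym (•²-assoc λ' α v) ⟩
      λ' •² (α •² v)       ≡⟨ cong (λ' •²_) (sym b₁≡αv) ⟩
      λ' •² b₁             ∎
    b₁∼v : b₁ ∼ v
    b₁∼v = ∼-sym (λ b₁≡0 → α≢0 (•²-≡0⇒≡0 v≢0 (trans (sym b₁≡αv) b₁≡0))) (α , b₁≡αv)
    conclude : inF λ' ⊎ IsFPoint b₁ → IsFPoint v
    conclude (inj₁ λ'∈F) = ⊥-elim (1≢0 (proj₂ (independent²-pair indep λ'∈F 1∈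
                         (sym (trans (•²-identityˡ b₂) b₂≡λb₁)))))
    conclude (inj₂ b₁-rational) = IsFPoint-∼ b₁-rational b₁∼v

  ∉F-multiple⇒weight>1 : ∀ {y ρ} → y ≢ (0# , 0#) → W y → W (ρ •² y) → ¬ inF ρ →
    Σ ℕ λ w → Weight K F W y w × 1 < w
  ∉F-multiple⇒weight>1 {y} {ρ} y≢0 y∈W ρy∈W ρ∉F =
    let w , 2≤w , T-dim = extend-to-basis (filter T? elements) (all-filter T? elements)
                            (λ μ μ∈T → ∈-filter⁺ T? (elements-complete μ) μ∈T)
                            (ρ ∷ 1# ∷ []) (ρy∈W ∷ subst W (sym (•²-identityˡ y)) y∈W ∷ [])
                            (independent-∉F∷1 ρ∉F)
    in w , HasDim-•² y y≢0 (λ { z (z∈W , μ , refl) → μ , z∈W , refl }) (λ μ μy∈W → μy∈W , μ , refl) T-dim ,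
       2≤w
    where
    T : Carrier → Set
    T μ = W (μ •² y)
    T? : ∀ μ → Dec (T μ)
    T? μ = W? (μ •² y)

  [weight>1⇒InPGFq]⇒Sidon :
    (∀ v → v ≢ (0# , 0#) → InL K F W v → (Σ ℕ λ w → Weight K F W v w × 1 < w) → InPGFq K F v) →
    IsSidon K F U
  [weight>1⇒InPGFq]⇒Sidon weight>1⇒InPGFq a b c d a∈U b∈U c∈U d∈U a≢0 b≢0 c≢0 d≢0 ab≡cd =
    by-cases (inF? ρ)
    where
    ρ : Carrier
    ρ = a * inv d d≢0
    ρ≢0 : ρ ≢ 0#
    ρ≢0 = *-≢0 a≢0 (inv-≢0 d d≢0)
    ρd≡a : ρ * d ≡ a
    ρd≡a = [x*y⁻¹]*y≡x a d d≢0
    ρb≡c : ρ * b ≡ c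
    ρb≡c = begin
      (a * inv d d≢0) * b  ≡⟨ xy*z≡xz*y a _ b ⟩
      (a * b) * inv d d≢0  ≡⟨ cong (_* inv d d≢0) ab≡cd ⟩
      (c * d) * inv d d≢0  ≡⟨ [x*y]*y⁻¹≡x c d d≢0 ⟩
      c                    ∎
    db≢0 : (d , b) ≢ (0# , 0#)
    db≢0 = d≢0 ∘ cong proj₁
    ρ∉F⇒db-rational : ¬ inF ρ → IsFPoint (d , b)
    ρ∉F⇒db-rational ρ∉F = InPGFq⇒IsFPoint (weight>1⇒InPGFq (d , b) db≢0
      ((d , b) , (d∈U , b∈U) , db≢0 , λ z → mk⇔ (λ z∈ → z∈) (λ z∈ → z∈))
      (∉F-multiple⇒weight>1 db≢0 (d∈U , b∈U) (subst U (sym ρd≡a) a∈U , subst U (sym ρb≡c) c∈U)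
                                  ρ∉F))
    by-cases : Dec (inF ρ) → (a ≐𝔽 c × b ≐𝔽 d) ⊎ (a ≐𝔽 d × b ≐𝔽 c)
    by-cases (yes ρ∈F) = inj₂ (≐-sym (𝔽-≐-scale (trans (sym ρd≡a) (*-comm ρ d)) ρ∈F ρ≢0) ,
                               𝔽-≐-scale (trans (sym ρb≡c) (*-comm ρ b)) ρ∈F ρ≢0)
    by-cases (no ρ∉F) = from-ratio (IsFPoint⇒ratio (ρ∉F⇒db-rational ρ∉F) d≢0)
      where
      from-ratio : (Σ Carrier λ σ → inF σ × b ≡ d * σ) → (a ≐𝔽 c × b ≐𝔽 d) ⊎ (a ≐𝔽 d × b ≐𝔽 c)
      from-ratio (σ , σ∈F , b≡dσ) = inj₁ (𝔽-≐-scale c≡aσ σ∈F σ≢0 , ≐-sym (𝔽-≐-scale b≡dσ σ∈F σ≢0))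
        where
        σ≢0 : σ ≢ 0#
        σ≢0 σ≡0 = b≢0 (trans b≡dσ (trans (cong (d *_) σ≡0) (zeroʳ d)))
        c≡aσ : c ≡ a * σ
        c≡aσ = begin
          c             ≡⟨ sym ρb≡c ⟩
          ρ * b         ≡⟨ cong (ρ *_) b≡dσ ⟩
          ρ * (d * σ)   ≡⟨ sym (*-assoc ρ d σ) ⟩
          (ρ * d) * σ   ≡⟨ cong (_* σ) ρd≡a ⟩
          a * σ         ∎

module PointCountArithmetic where

  open import Data.Nat using (suc; _+_; _*_; _∸_)
  open import Data.Nat.Properties using (+-cancelʳ-≡; suc-injective; m+n∸m≡n)
  open import Data.Nat.Tactic.RingSolver using (solve-∀)
  open import Relation.Binary.PropositionalEquality

  private
    square-expansion : ∀ B t →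
      suc (B + t) * suc (B + t) ≡ suc ((B + t) * t + (suc B + 1) * B + suc (suc B) * t)
    square-expansion = solve-∀

  point-count-arithmetic : ∀ {N B t q Q} → suc B ≡ q → suc (B + t) ≡ Q →
    suc (N * B + suc q * t) ≡ Q * Q → N * (q ∸ 1) ≡ (Q ∸ 1) * (Q ∸ q) + (q + 1) * (q ∸ 1)
  point-count-arithmetic {N} {B} {t} refl refl vectors = begin
    N * B                                   ≡⟨ +-cancelʳ-≡ (suc (suc B) * t) _ _
                                                 (suc-injective (trans vectors (square-expansion B t))) ⟩
    (B + t) * t + (suc B + 1) * B           ≡⟨ cong (λ u → (B + t) * u + (suc B + 1) * B)
                                                    (sym (m+n∸m≡n B t)) ⟩
    (B + t) * (B + t ∸ B) + (suc B + 1) * B ∎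
    where open ≡-Reasoning

module PointCount
  (K : FiniteField) (F : Subfield K) {q : ℕ} (cardF : SetCard K (Subfield.mem F) q)
  (U : FiniteField.Carrier K → Set) (U-subspace : IsFSubspace K F U)
  {k : ℕ} (U-dim : HasDim K (KasSpace K) F U (suc k))
  (sidon : IsSidon K F U)
  where

  import Data.Nat as Nat
  open Nat using (_^_)
  open import Data.Product using (Σ; _×_; _,_; proj₁; proj₂)
  open import Data.Sum using (_⊎_; inj₁; inj₂)
  open import Data.Empty using (⊥-elim)
  open import Function.Base using (_∘_)
  open import Data.List using (List; length; map; filter; cartesianProduct)
  open import Data.List.Properties using (length-map)
  open import Data.List.Membership.Propositional using (_∈_)
  open import Data.List.Membership.Propositional.Properties
    using (∈-map⁺; ∈-map⁻; ∈-filter⁺; ∈-filter⁻; ∈-cartesianProduct⁺; ∈-cartesianProduct⁻)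
  open import Data.List.Relation.Unary.All as All using ()
  open import Data.List.Relation.Unary.Unique.Propositional using (Unique)
  import Data.List.Relation.Unary.Unique.Propositional.Properties as Unique
  open import Function.Bundles using (_⇔_; mk⇔; Equivalence)
  open import Relation.Binary.PropositionalEquality
  open import Relation.Nullary using (¬_)

  open SidonSpaces K F cardF U U-subspace U-dim public
  open ListCounting
  open WithDecidableEquality _≟_ using (_without_; ∈-without⁻; ∈-without⁺; without-unique; length-without)
  open WithDecidableEquality _≟²_ using ()
    renaming (_without_ to _without²_; ∈-without⁻ to ∈-without²⁻; ∈-without⁺ to ∈-without²⁺;
              without-unique to without²-unique; length-without to length-without²)

  Ulist : List Carrier
  Ulist = proj₁ U-card

  Ulist-unique : Unique Ulist
  Ulist-unique = proj₁ (proj₂ U-card)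

  Ulist-sound : ∀ {x} → x ∈ Ulist → U x
  Ulist-sound = All.lookup (proj₁ (proj₂ (proj₂ U-card)))

  Ulist-complete : ∀ x → U x → x ∈ Ulist
  Ulist-complete = proj₁ (proj₂ (proj₂ (proj₂ U-card)))

  length-Ulist : length Ulist ≡ q ^ suc k
  length-Ulist = proj₂ (proj₂ (proj₂ (proj₂ U-card)))

  nonzeroW : List K²
  nonzeroW = cartesianProduct Ulist Ulist without² (0# , 0#)

  nonzeroW-unique : Unique nonzeroW
  nonzeroW-unique = without²-unique (0# , 0#) (Unique.cartesianProduct⁺ Ulist-unique Ulist-unique)

  ∈-nonzeroW⁻ : ∀ {x} → x ∈ nonzeroW → W x × x ≢ (0# , 0#)
  ∈-nonzeroW⁻ x∈ =
    let x∈U² , x≢0 = ∈-without²⁻ x∈ ; x₁∈ , x₂∈ = ∈-cartesianProduct⁻ Ulist Ulist x∈U²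
    in (Ulist-sound x₁∈ , Ulist-sound x₂∈) , x≢0

  ∈-nonzeroW⁺ : ∀ {x} → W x → x ≢ (0# , 0#) → x ∈ nonzeroW
  ∈-nonzeroW⁺ (x₁∈U , x₂∈U) x≢0 =
    ∈-without²⁺ (∈-cartesianProduct⁺ (Ulist-complete _ x₁∈U) (Ulist-complete _ x₂∈U)) x≢0

  length-nonzeroW : suc (length nonzeroW) ≡ q ^ suc k Nat.* q ^ suc k
  length-nonzeroW =
    trans (length-without² (Unique.cartesianProduct⁺ Ulist-unique Ulist-unique)
                           (∈-cartesianProduct⁺ (Ulist-complete 0# 0∈U) (Ulist-complete 0# 0∈U)))
          (trans (length-cartesianProductWith _,_ Ulist Ulist) (cong₂ Nat._*_ length-Ulist length-Ulist))

  open EquivalenceClasses _≟²_ _∼_ _∼?_ nonzeroW nonzeroW-unique ∼-refl ∼-trans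
    (λ y∈ → ∼-sym (proj₂ (∈-nonzeroW⁻ y∈)))

  ∼-rep : ∀ {x} → x ∈ nonzeroW → x ∼ rep x
  ∼-rep x∈ = ∼-sym (proj₂ (∈-nonzeroW⁻ x∈)) (rep-∼ x∈)

  points : PointCard K F W (length reps)
  points = reps ,
    All.tabulate (∈-nonzeroW⁻ ∘ proj₁ ∘ ∈-reps⁻) ,
    unique⇒allPairs reps-unique (λ r∈ r'∈ r≐r' → reps-injective r∈ r'∈ (⟨⟩≐⇒∼ r≐r')) ,
    (λ v v≢0 (w , w∈W , w≢0 , w≐v) → let w∈ = ∈-nonzeroW⁺ w∈W w≢0 in
      rep w , rep-∈-reps w∈ , ≐²-trans (∼⇒⟨⟩≐ w≢0 (rep-∼ w∈)) w≐v) ,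
    refl

  length-class : ∀ {r c} → r ∈ reps → r ∼ c → c ≢ (0# , 0#) →
    ∀ {L} → Unique L → (∀ ν → ν ≢ 0# → W (ν •² c) ⇔ ν ∈ L) → length (class r) ≡ length (L without 0#)
  length-class {r} {c} r∈ r∼c c≢0 {L} L-unique W⇔L =
    trans (length-unique-≡ (class-unique r) (Unique.map⁺ (•²-injective c≢0) (without-unique 0# L-unique))
                           (mk⇔ to from))
          (length-map (_•² c) (L without 0#))
    where
    to-multiple : ∀ {x} → x ∈ nonzeroW → (Σ Carrier λ ν → x ≡ ν •² c) → x ∈ map (_•² c) (L without 0#)
    to-multiple x∈ (ν , refl) = ∈-map⁺ (_•² c) (∈-without⁺ (Equivalence.to (W⇔L ν ν≢0) x∈W) ν≢0)
      where
      x∈W : W (ν •² c)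
      x∈W = proj₁ (∈-nonzeroW⁻ x∈)
      ν≢0 : ν ≢ 0#
      ν≢0 = •²-≢0⇒≢0 (proj₂ (∈-nonzeroW⁻ x∈))
    to : ∀ {x} → x ∈ class r → x ∈ map (_•² c) (L without 0#)
    to x∈ = let x∈Z , r∼x = Equivalence.to (∈-class⇔ r∈) x∈
            in to-multiple x∈Z (∼-trans (∼-sym c≢0 r∼c) r∼x)
    from-multiple : ∀ {ν} → ν ∈ L without 0# → ν •² c ∈ class r
    from-multiple {ν} ν∈ = let ν∈L , ν≢0 = ∈-without⁻ ν∈ in
      Equivalence.from (∈-class⇔ r∈)
        (∈-nonzeroW⁺ (Equivalence.from (W⇔L ν ν≢0) ν∈L) (ν≢0 ∘ •²-≡0⇒≡0 c≢0) ,
         ∼-trans r∼c (ν , refl))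
    from : ∀ {x} → x ∈ map (_•² c) (L without 0#) → x ∈ class r
    from x∈ = let ν , ν∈ , x≡νc = ∈-map⁻ (_•² c) x∈
              in subst (_∈ class r) (sym x≡νc) (from-multiple ν∈)

  length-class-rational : ∀ {r} → r ∈ reps → IsFPoint r → length (class r) ≡ length (Ulist without 0#)
  length-class-rational {r} r∈ (c , c∈F² , c∼r) =
    length-class r∈ (∼-sym r≢0 c∼r) (proj₂ (proj₂ c∈F²)) Ulist-unique
      (λ ν _ → mk⇔ (Ulist-complete ν ∘ Equivalence.to (•²-∈W⇔ c∈F² ν))
                   (Equivalence.from (•²-∈W⇔ c∈F² ν) ∘ Ulist-sound))
    where
    r≢0 : r ≢ (0# , 0#)
    r≢0 = proj₂ (∈-nonzeroW⁻ (proj₁ (∈-reps⁻ r∈)))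

  length-class-irrational : ∀ {r} → r ∈ reps → ¬ IsFPoint r → length (class r) ≡ length (Flist without 0#)
  length-class-irrational {r} r∈ r-irrational =
    length-class r∈ (∼-refl r) r≢0 Flist-unique
      (λ ν ν≢0 → mk⇔ (λ νr∈W → Flist-complete ν
                                  (scalar-∈F (Sidon⇒scalar∈F⊎IsFPoint sidon r∈W νr∈W ν≢0)))
                     (λ ν∈Flist → let ν∈F = All.lookup Flist-sound ν∈Flist in
                        scale-closed ν∈F (proj₁ r∈W) , scale-closed ν∈F (proj₂ r∈W)))
    where
    r∈W : W r
    r∈W = proj₁ (∈-nonzeroW⁻ (proj₁ (∈-reps⁻ r∈)))
    r≢0 : r ≢ (0# , 0#)
    r≢0 = proj₂ (∈-nonzeroW⁻ (proj₁ (∈-reps⁻ r∈)))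
    scalar-∈F : ∀ {ν} → inF ν ⊎ IsFPoint r → inF ν
    scalar-∈F (inj₁ ν∈F) = ν∈F
    scalar-∈F (inj₂ r-rational) = ⊥-elim (r-irrational r-rational)

  rationalReps : List K²
  rationalReps = filter IsFPoint? reps

  -- For a fixed nonzero u₀ ∈ U, c ↦ rep (u₀ c) maps the canonical F-points bijectively onto the
  -- rational representatives.
  length-rationalReps : length rationalReps ≡ suc q
  length-rationalReps =
    trans (length-unique-≡ (Unique.filter⁺ IsFPoint? reps-unique)
                           (map⁺-∈ canonicalRep canonicalPoints-unique canonicalRep-injective) (mk⇔ to from))
          (trans (length-map canonicalRep canonicalPoints) length-canonicalPoints)
    where
    u₀ : Carrier
    u₀ = proj₁ (HasDim-suc⇒nonzero U-dim)
    u₀∈U : U u₀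
    u₀∈U = proj₁ (proj₂ (HasDim-suc⇒nonzero U-dim))
    u₀≢0 : u₀ ≢ 0#
    u₀≢0 = proj₂ (proj₂ (HasDim-suc⇒nonzero U-dim))
    c≢0 : ∀ {c} → c ∈ canonicalPoints → c ≢ (0# , 0#)
    c≢0 = proj₂ ∘ proj₂ ∘ canonicalPoints-IsFVector
    u₀c∈ : ∀ {c} → c ∈ canonicalPoints → u₀ •² c ∈ nonzeroW
    u₀c∈ c∈ = ∈-nonzeroW⁺ (Equivalence.from (•²-∈W⇔ (canonicalPoints-IsFVector c∈) u₀) u₀∈U)
                          (u₀≢0 ∘ •²-≡0⇒≡0 (c≢0 c∈))
    u₀c∼c : ∀ {c} → c ∈ canonicalPoints → u₀ •² c ∼ c
    u₀c∼c c∈ = ∼-sym (proj₂ (∈-nonzeroW⁻ (u₀c∈ c∈))) (u₀ , refl)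
    canonicalRep : K² → K²
    canonicalRep c = rep (u₀ •² c)
    canonicalRep-injective : ∀ {c c'} → c ∈ canonicalPoints → c' ∈ canonicalPoints →
      canonicalRep c ≡ canonicalRep c' → c ≡ c'
    canonicalRep-injective c∈ c'∈ reps≡ = canonicalPoints-∼-injective c∈ c'∈
      (∼-trans (u₀ , refl) (∼-trans (∼-rep (u₀c∈ c∈))
        (subst (_∼ _) (sym reps≡) (∼-trans (rep-∼ (u₀c∈ c'∈)) (u₀c∼c c'∈)))))
    to : ∀ {r} → r ∈ rationalReps → r ∈ map canonicalRep canonicalPoints
    to r∈ =
      let r∈reps , r-rational = ∈-filter⁻ IsFPoint? {xs = reps} r∈
          r∈Z , rep-r≡r = ∈-reps⁻ r∈reps
          c , c∈ , c∼r = IsFPoint⇒canonical r-rational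
      in subst (_∈ map canonicalRep canonicalPoints)
               (trans (rep-cong (u₀c∈ c∈) r∈Z (∼-trans (u₀c∼c c∈) c∼r)) rep-r≡r)
               (∈-map⁺ canonicalRep c∈)
    from : ∀ {r} → r ∈ map canonicalRep canonicalPoints → r ∈ rationalReps
    from r∈ =
      let c , c∈ , r≡ = ∈-map⁻ canonicalRep r∈
      in subst (_∈ rationalReps) (sym r≡)
           (∈-filter⁺ IsFPoint? (rep-∈-reps (u₀c∈ c∈))
             (IsFPoint-∼ (c , canonicalPoints-IsFVector c∈ , u₀ , refl) (∼-rep (u₀c∈ c∈))))

  point-count : Σ ℕ λ N → PointCard K F W N ×
    N Nat.* (q Nat.∸ 1) ≡ (q ^ suc k Nat.∸ 1) Nat.* (q ^ suc k Nat.∸ q) Nat.+ (q Nat.+ 1) Nat.* (q Nat.∸ 1)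
  point-count = length reps , points ,
    point-count-arithmetic {N = length reps} suc-B≡q (trans (cong suc (sym A≡B+t)) suc-A≡q^k)
    (begin
      suc (length reps Nat.* B Nat.+ suc q Nat.* t)
        ≡⟨ cong (λ n → suc (length reps Nat.* B Nat.+ n Nat.* t)) (sym length-rationalReps) ⟩
      suc (length reps Nat.* B Nat.+ length rationalReps Nat.* t)
        ≡⟨ cong suc (sym nonzeroW-by-classes) ⟩
      suc (length nonzeroW)
        ≡⟨ length-nonzeroW ⟩
      q ^ suc k Nat.* q ^ suc k ∎)
    where
    open ≡-Reasoning
    open PointCountArithmetic using (point-count-arithmetic)
    open import Data.Nat.Properties using (m≤m*n; m^n≢0; m+[n∸m]≡n)
    B A : ℕ
    B = length (Flist without 0#)
    A = length (Ulist without 0#)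
    suc-B≡q : suc B ≡ q
    suc-B≡q = trans (length-without Flist-unique (Flist-complete 0# 0∈)) length-Flist
    suc-A≡q^k : suc A ≡ q ^ suc k
    suc-A≡q^k = trans (length-without Ulist-unique (Ulist-complete 0# 0∈U)) length-Ulist
    B≤A : B Nat.≤ A
    B≤A = Nat.s≤s⁻¹ (subst (suc B Nat.≤_) (trans (cong (_^ suc k) suc-B≡q) (sym suc-A≡q^k))
                                        (m≤m*n (suc B) (suc B ^ k) {{m^n≢0 (suc B) k}}))
    t : ℕ
    t = A Nat.∸ B
    A≡B+t : A ≡ B Nat.+ t
    A≡B+t = sym (m+[n∸m]≡n B≤A)
    nonzeroW-by-classes : length nonzeroW ≡ length reps Nat.* B Nat.+ length rationalReps Nat.* t
    nonzeroW-by-classes = trans length-classes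
      (sum-map-split IsFPoint? (λ r → length (class r)) B t reps
        (λ r∈ → (λ r-rational → trans (length-class-rational r∈ r-rational) A≡B+t) ,
                length-class-irrational r∈))

open import Data.Nat using (ℕ; suc; _+_; _*_; _∸_; _^_; _≤_; _<_; s≤s; z≤n)
open import Data.Product using (Σ; _×_; _,_)
open import Function.Bundles using (_⇔_; mk⇔)
open import Relation.Binary.PropositionalEquality using (_≡_)

theorem6p1 : (q n k : ℕ) → IsPrimePower q → 1 ≤ n → 1 ≤ k →
    (K : FiniteField) → FieldCard K (q ^ n) →
    (F : Subfield K) → SetCard K (Subfield.mem F) q →
    (U : FiniteField.Carrier K → Set) → IsFSubspace K F U →
    HasDim K (KasSpace K) F U k →
      (IsSidon K F U ⇔
         (∀ v → NonZero² K F v → InL K F (_×ˢ_ K F U U) v →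
            (Σ ℕ λ w → Weight K F (_×ˢ_ K F U U) v w × 1 < w) →
            InPGFq K F v))
    × (∀ v → NonZero² K F v → InL K F (_×ˢ_ K F U U) v → InPGFq K F v →
         Weight K F (_×ˢ_ K F U U) v k)
    × (IsSidon K F U →
         Σ ℕ λ N → PointCard K F (_×ˢ_ K F U U) N
           × N * (q ∸ 1) ≡ (q ^ k ∸ 1) * (q ^ k ∸ q) + (q + 1) * (q ∸ 1))
theorem6p1 q n (suc k) _ _ (s≤s z≤n) K _ F cardF U U-subspace U-dim =
  mk⇔ (λ sidon v v≢0 _ → Sidon⇒weight>1⇒InPGFq sidon v v≢0) [weight>1⇒InPGFq]⇒Sidon ,
  (λ v _ _ → InPGFq⇒weight-k v) ,
  PointCount.point-count K F cardF U U-subspace U-dim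
  where open SidonSpaces K F cardF U U-subspace U-dim
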